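{- Let $(G,f)$ be a SED-pair of order $n$, with $G=(V,E)$. Let $E_+ = \{e \in E : f(e)=1\}$, $E_- = \{e\in E : f(e) = -1\}$, and for each vertex $v$ let $s_v = \sum_{e \ni v} f(e)$ (sum over edges containing $v$). Let $V_+ = \{v \in V : s_v \geq 0\}$ and $V_- = \{v\in V : s_v < 0\}$. Suppose that every edge of $E_-$ joins a vertex of $V_+$ with a vertex of $V_-$, and every edge of $E_+$ joins two vertices of $V_+$. Then \[ s[(G,f)] \geq -\frac{1}{54}n^2. \]
   Context: All graphs are finite, simple and undirected. For an edge $e=(u,v)$ of $G$, its closed edge-neighborhood $N[e]$ is the set consisting of $e$ and all edges of $G$ sharing an endpoint with $e$. A function $f: E \to \{+1,-1\}$ is a signed edge domination function of $G=(V,E)$ if $\sum_{e' \in N[e]} f(e') \geq 1$ for every $e \in E$; in this case $(G,f)$ is called a SED-pair of order $|V|$. For such a pair, $s[(G,f)] = \sum_{e\in E} f(e)$. -}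

module Defs where

open import Data.Bool using (Bool; true; false; T)
open import Data.Nat using (ℕ; zero; suc)
open import Data.Fin using (Fin; zero; suc)
open import Data.Integer using (ℤ; +_; -_; _+_; _-_; _*_; _≤_; _<_; 0ℤ; 1ℤ)
open import Data.Product using (_×_)
open import Relation.Nullary using (¬_)
import Relation.Nullary
open import Relation.Nullary.Decidable using (⌊_⌋)
import Data.Fin as F
open import Relation.Binary.PropositionalEquality using (_≡_)

record Graph (n : ℕ) : Set where
  field
    adj   : Fin n → Fin n → Bool
    sym   : ∀ i j → adj i j ≡ adj j i
    irref : ∀ i → adj i i ≡ false
open Graph public

data Sign : Set where
  plus minus : Sign

⟦_⟧ : Sign → ℤ
⟦ plus ⟧  = 1ℤ
⟦ minus ⟧ = - 1ℤ

-- An edge labelling of G: a function on ordered pairs that is symmetric,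
-- so that it is a function on unordered pairs {i,j}; only its values on
-- edges are ever used.
record EdgeLabelling {n : ℕ} (G : Graph n) : Set where
  field
    lab     : Fin n → Fin n → Sign
    lab-sym : ∀ i j → lab i j ≡ lab j i
open EdgeLabelling public

Σℤ : (n : ℕ) → (Fin n → ℤ) → ℤ
Σℤ zero    g = 0ℤ
Σℤ (suc n) g = g zero + Σℤ n (λ i → g (suc i))

contrib : {n : ℕ} (G : Graph n) → EdgeLabelling G → Fin n → Fin n → ℤ
contrib G f i j with adj G i j
... | true  = ⟦ lab f i j ⟧
... | false = 0ℤ

sv : {n : ℕ} (G : Graph n) → EdgeLabelling G → Fin n → ℤ
sv {n} G f v = Σℤ n (λ u → contrib G f v u)

-- Edge {u,v}: closed neighbourhood sum = s_u + s_v - f(uv)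
-- (the edge uv is counted in both s_u and s_v).
closedNbSum : {n : ℕ} (G : Graph n) → EdgeLabelling G → Fin n → Fin n → ℤ
closedNbSum G f u v = sv G f u + sv G f v - ⟦ lab f u v ⟧

IsSEDF : {n : ℕ} (G : Graph n) → EdgeLabelling G → Set
IsSEDF G f = ∀ u v → T (adj G u v) → 1ℤ ≤ closedNbSum G f u v

weight : {n : ℕ} (G : Graph n) → EdgeLabelling G → ℤ
weight {n} G f =
  Σℤ n (λ i → Σℤ n (λ j → if⌊ i F.<? j ⌋ (contrib G f i j)))
  where
    if⌊_⌋ : {P : Set} → Relation.Nullary.Dec P → ℤ → ℤ
    if⌊ Relation.Nullary.yes _ ⌋ z = z
    if⌊ Relation.Nullary.no _ ⌋ z = 0ℤ

InV₊ : {n : ℕ} (G : Graph n) → EdgeLabelling G → Fin n → Set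
InV₊ G f v = 0ℤ ≤ sv G f v

InV₋ : {n : ℕ} (G : Graph n) → EdgeLabelling G → Fin n → Set
InV₋ G f v = sv G f v < 0ℤ

Structured : {n : ℕ} (G : Graph n) → EdgeLabelling G → Set
Structured G f =
  (∀ u v → T (adj G u v) → lab f u v ≡ minus →
     (InV₊ G f u × InV₋ G f v) Data.Sum.⊎ (InV₋ G f u × InV₊ G f v))
  × (∀ u v → T (adj G u v) → lab f u v ≡ plus → InV₊ G f u × InV₊ G f v)
  where import Data.Sum

{-# OPTIONS --safe #-}

-- Write Y_u = deg₊ u and X_u = deg₋ u for the numbers of plus and minus edges at u, so that
-- s_u = Y_u - X_u and 2 s[(G,f)] = Σ Y - Σ X.  The hypotheses say that vertices of V₋ carry no plus
-- edge, that every minus edge has exactly one end in V₊, and (domination at a minus edge uv with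
-- u ∈ V₊) that X_v ≤ s_u.  Put H_u = s_u on V₊, H_u = 0 on V₋ and R_u = Y_u / H_u.  Then
-- Y_u = R_u H_u and 2 s[(G,f)] = 2 Σ H - Σ Y, and Σ R ≤ n because R_u - 1 = X_u / s_u is at most
-- Σ 1 / X_v over the minus neighbours v of u, while each v ∈ V₋ hands out 1 in total.  Counting paths
-- of length two, Σ Y² = Σ_{v,w} codeg(v,w) ≤ Σ_{v,w} min (Y_v, Y_w) ≤ Σ H · Σ R ≤ n Σ H.  Summing
-- AM-GM for 27 n H_u, n² R_u and 27 Y_u² over u then gives 27 Σ Y ≤ 54 Σ H + n², that is
-- 54 s[(G,f)] = 27 (2 Σ H - Σ Y) ≥ -n².

module Submission where

open import Defs hiding (sym)

open import Data.Nat using (ℕ; zero; suc)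
open import Data.Fin as Fin using (Fin)
open import Data.List using (_∷_; [])
open import Data.Bool using (Bool; true; false; T)
open import Data.Product using (_×_; _,_; proj₁; proj₂)
open import Data.Sum as Sum using (_⊎_; inj₁; inj₂)
open import Data.Empty using (⊥; ⊥-elim)
open import Data.Rational.Literals using (fromℤ)
open import Data.Vec.Functional using (Vector; removeAt)
open import Relation.Nullary using (yes; no)
open import Relation.Binary.Definitions using (tri<; tri≈; tri>)
open import Relation.Nullary.Decidable using (dec⇒maybe)
open import Relation.Binary.PropositionalEquality
  using (_≡_; _≢_; ≢-sym; refl; sym; trans; cong; cong₂; subst; subst₂; module ≡-Reasoning)
open import Algebra.Bundles using (CommutativeRing)
open import Tactic.RingSolver using (solve; solve-∀)
open import Tactic.RingSolver.Core.AlmostCommutativeRing using (AlmostCommutativeRing; fromCommutativeRing)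

module Inequalities where
  open import Data.Rational
    using ( ℚ; 0ℚ; 1ℚ; ½; _+_; _*_; -_; _-_; _≤_; _<_; *≤*; 1/_
          ; ≢-nonZero; nonNegative; nonPositive; positive)
  open import Data.Rational.Properties
  import Data.Integer as ℤ
  import Data.Integer.Properties as ℤP
  import Data.Rational.Unnormalised as ℚᵘ
  import Data.Rational.Unnormalised.Properties as ℚᵘP
  open import Algebra.Properties.Semiring.Sum (CommutativeRing.semiring +-*-commutativeRing)
    using ( sum; sum-syntax; ∑-comm; ∑-distrib-+; *-distribˡ-sum; *-distribʳ-sum
          ; sum-cong-≗; sum-remove; sum-replicate-zero)

  ℚ-ring : AlmostCommutativeRing _ _
  ℚ-ring = fromCommutativeRing +-*-commutativeRing (λ p → dec⇒maybe (0ℚ ≟ p))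

  fromℕ : ℕ → ℚ
  fromℕ m = fromℤ (ℤ.+ m)

  0≤+ : ∀ {p q} → 0ℚ ≤ p → 0ℚ ≤ q → 0ℚ ≤ p + q
  0≤+ {p} {q} 0≤p 0≤q =
    nonNegative⁻¹ _ {{nonNeg+nonNeg⇒nonNeg p {{nonNegative 0≤p}} q {{nonNegative 0≤q}}}}

  0≤* : ∀ {p q} → 0ℚ ≤ p → 0ℚ ≤ q → 0ℚ ≤ p * q
  0≤* {p} {q} 0≤p 0≤q =
    nonNegative⁻¹ _ {{nonNeg*nonNeg⇒nonNeg p {{nonNegative 0≤p}} q {{nonNegative 0≤q}}}}

  0≤sq : ∀ p → 0ℚ ≤ p * p
  0≤sq p with ≤-total 0ℚ p
  ... | inj₁ 0≤p = 0≤* 0≤p 0≤p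
  ... | inj₂ p≤0 = nonNegative⁻¹ _ {{nonPos*nonPos⇒nonPos p {{nonPositive p≤0}} p {{nonPositive p≤0}}}}

  ≤-by-gap : ∀ {p q} d → 0ℚ ≤ d → p + d ≡ q → p ≤ q
  ≤-by-gap {p} d 0≤d refl = subst (_≤ p + d) (+-identityʳ p) (+-monoʳ-≤ p 0≤d)

  *-monoˡ-≤-0≤ : ∀ {r p q} → 0ℚ ≤ r → p ≤ q → r * p ≤ r * q
  *-monoˡ-≤-0≤ {r} 0≤r = *-monoˡ-≤-nonNeg r {{nonNegative 0≤r}}

  *-monoʳ-≤-0≤ : ∀ {r p q} → 0ℚ ≤ r → p ≤ q → p * r ≤ q * r
  *-monoʳ-≤-0≤ {r} 0≤r = *-monoʳ-≤-nonNeg r {{nonNegative 0≤r}}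

  sq-<-sq : ∀ {p q} → 0ℚ ≤ p → p < q → p * p < q * q
  sq-<-sq {p} {q} 0≤p p<q =
    ≤-<-trans (*-monoˡ-≤-0≤ 0≤p (<⇒≤ p<q)) (*-monoˡ-<-pos q {{positive (≤-<-trans 0≤p p<q)}} p<q)

  cube-<-cube : ∀ {p q} → 0ℚ ≤ p → p < q → p * p * p < q * q * q
  cube-<-cube {p} {q} 0≤p p<q =
    ≤-<-trans (*-monoʳ-≤-0≤ 0≤p (<⇒≤ p²<q²)) (*-monoʳ-<-pos (q * q) {{positive 0<q²}} p<q)
    where
    p²<q² = sq-<-sq 0≤p p<q
    0<q² = ≤-<-trans (0≤sq p) p²<q²

  sq-cancel-≤ : ∀ {p q} → 0ℚ ≤ q → p * p ≤ q * q → p ≤ q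
  sq-cancel-≤ 0≤q p²≤q² = ≮⇒≥ (λ q<p → <-irrefl refl (<-≤-trans (sq-<-sq 0≤q q<p) p²≤q²))

  cube-cancel-≤ : ∀ {p q} → 0ℚ ≤ q → p * p * p ≤ q * q * q → p ≤ q
  cube-cancel-≤ 0≤q p³≤q³ = ≮⇒≥ (λ q<p → <-irrefl refl (<-≤-trans (cube-<-cube 0≤q q<p) p³≤q³))

  amgm₂ : ∀ {m a b} → 0ℚ ≤ a → 0ℚ ≤ b → m * m ≤ a * b → m + m ≤ a + b
  amgm₂ {m} {a} {b} 0≤a 0≤b m²≤ab = sq-cancel-≤ (0≤+ 0≤a 0≤b) (begin
    (m + m) * (m + m)  ≡⟨ solve (m ∷ []) ℚ-ring ⟩
    fromℕ 4 * (m * m)  ≤⟨ *-monoˡ-≤-0≤ (nonNegative⁻¹ (fromℕ 4)) m²≤ab ⟩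
    fromℕ 4 * (a * b)  ≤⟨ ≤-by-gap ((a - b) * (a - b)) (0≤sq (a - b)) (solve (a ∷ b ∷ []) ℚ-ring) ⟩
    (a + b) * (a + b)  ∎)
    where open ≤-Reasoning

  cube-of-sum : ∀ a b c → fromℕ 27 * (a * b * c)
                          + ½ * ((fromℕ 7 * a + b + c) * ((b - c) * (b - c))
                               + (fromℕ 7 * b + c + a) * ((c - a) * (c - a))
                               + (fromℕ 7 * c + a + b) * ((a - b) * (a - b)))
                        ≡ (a + b + c) * (a + b + c) * (a + b + c)
  cube-of-sum = solve-∀ ℚ-ring

  amgm₃ : ∀ {m a b c} → 0ℚ ≤ a → 0ℚ ≤ b → 0ℚ ≤ c → m * m * m ≤ a * b * c →
          m + m + m ≤ a + b + c
  amgm₃ {m} {a} {b} {c} 0≤a 0≤b 0≤c m³≤abc = cube-cancel-≤ 0≤a+b+c (begin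
    (m + m + m) * (m + m + m) * (m + m + m)  ≡⟨ solve (m ∷ []) ℚ-ring ⟩
    fromℕ 27 * (m * m * m)                   ≤⟨ *-monoˡ-≤-0≤ (nonNegative⁻¹ (fromℕ 27)) m³≤abc ⟩
    fromℕ 27 * (a * b * c)                   ≤⟨ ≤-by-gap (½ * gap) (0≤* (nonNegative⁻¹ ½) 0≤gap)
                                                  (cube-of-sum a b c) ⟩
    (a + b + c) * (a + b + c) * (a + b + c)  ∎)
    where
    open ≤-Reasoning
    0≤a+b+c = 0≤+ (0≤+ 0≤a 0≤b) 0≤c
    0≤7x+y+z : ∀ {x y z} → 0ℚ ≤ x → 0ℚ ≤ y → 0ℚ ≤ z → 0ℚ ≤ fromℕ 7 * x + y + z
    0≤7x+y+z 0≤x 0≤y 0≤z = 0≤+ (0≤+ (0≤* (nonNegative⁻¹ (fromℕ 7)) 0≤x) 0≤y) 0≤z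
    gap = (fromℕ 7 * a + b + c) * ((b - c) * (b - c))
        + (fromℕ 7 * b + c + a) * ((c - a) * (c - a))
        + (fromℕ 7 * c + a + b) * ((a - b) * (a - b))
    0≤gap = 0≤+ (0≤+ (0≤* (0≤7x+y+z 0≤a 0≤b 0≤c) (0≤sq (b - c)))
                     (0≤* (0≤7x+y+z 0≤b 0≤c 0≤a) (0≤sq (c - a))))
                (0≤* (0≤7x+y+z 0≤c 0≤a 0≤b) (0≤sq (a - b)))

  fromℤ-+ : ∀ i j → fromℤ (i ℤ.+ j) ≡ fromℤ i + fromℤ j
  fromℤ-+ i j =
    toℚᵘ-injective (ℚᵘP.≃-trans (ℚᵘ.*≡* eq) (ℚᵘP.≃-sym (toℚᵘ-homo-+ (fromℤ i) (fromℤ j))))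
    where
    eq : (i ℤ.+ j) ℤ.* ℤ.+ 1 ≡ (i ℤ.* ℤ.+ 1 ℤ.+ j ℤ.* ℤ.+ 1) ℤ.* ℤ.+ 1
    eq = cong (ℤ._* ℤ.+ 1) (cong₂ ℤ._+_ (sym (ℤP.*-identityʳ i)) (sym (ℤP.*-identityʳ j)))

  fromℤ-* : ∀ i j → fromℤ (i ℤ.* j) ≡ fromℤ i * fromℤ j
  fromℤ-* i j =
    toℚᵘ-injective (ℚᵘP.≃-trans (ℚᵘ.*≡* refl) (ℚᵘP.≃-sym (toℚᵘ-homo-* (fromℤ i) (fromℤ j))))

  fromℤ-neg : ∀ i → fromℤ (ℤ.- i) ≡ - fromℤ i
  fromℤ-neg (ℤ.+ zero)  = refl
  fromℤ-neg (ℤ.+ suc _) = refl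
  fromℤ-neg ℤ.-[1+ _ ] = refl

  fromℤ-sub : ∀ i j → fromℤ (i ℤ.- j) ≡ fromℤ i - fromℤ j
  fromℤ-sub i j = trans (fromℤ-+ i (ℤ.- j)) (cong (fromℤ i +_) (fromℤ-neg j))

  fromℤ-mono-≤ : ∀ {i j} → i ℤ.≤ j → fromℤ i ≤ fromℤ j
  fromℤ-mono-≤ {i} {j} i≤j = *≤* (subst₂ ℤ._≤_ (sym (ℤP.*-identityʳ i)) (sym (ℤP.*-identityʳ j)) i≤j)

  fromℤ-cancel-≤ : ∀ {i j} → fromℤ i ≤ fromℤ j → i ℤ.≤ j
  fromℤ-cancel-≤ {i} {j} (*≤* i≤j) = subst₂ ℤ._≤_ (ℤP.*-identityʳ i) (ℤP.*-identityʳ j) i≤j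

  ≤⇒0≤- : ∀ {p q} → p ≤ q → 0ℚ ≤ q - p
  ≤⇒0≤- {p} {q} p≤q = subst (_≤ q - p) (+-inverseʳ p) (+-monoˡ-≤ (- p) p≤q)

  0≤-⇒≤ : ∀ {p q} → 0ℚ ≤ q - p → p ≤ q
  0≤-⇒≤ {p} {q} 0≤q-p = ≤-by-gap (q - p) 0≤q-p (p+[q-p]≡q p q)
    where
    p+[q-p]≡q : ∀ p q → p + (q - p) ≡ q
    p+[q-p]≡q = solve-∀ ℚ-ring

  indicator-nonneg : ∀ {x} → x ≡ 0ℚ ⊎ x ≡ 1ℚ → 0ℚ ≤ x
  indicator-nonneg (inj₁ refl) = ≤-refl
  indicator-nonneg (inj₂ refl) = nonNegative⁻¹ 1ℚ

  indicator≤1 : ∀ {x} → x ≡ 0ℚ ⊎ x ≡ 1ℚ → x ≤ 1ℚ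
  indicator≤1 (inj₁ refl) = nonNegative⁻¹ 1ℚ
  indicator≤1 (inj₂ refl) = ≤-refl

  recip : ℚ → ℚ
  recip p with p ≟ 0ℚ
  ... | yes _   = 0ℚ
  ... | no  p≢0 = (1/ p) {{≢-nonZero p≢0}}

  *-recip : ∀ {p} → p ≢ 0ℚ → p * recip p ≡ 1ℚ
  *-recip {p} p≢0 with p ≟ 0ℚ
  ... | yes p≡0  = ⊥-elim (p≢0 p≡0)
  ... | no  p≢0′ = *-inverseʳ p {{≢-nonZero p≢0′}}

  *-recip-≤-1 : ∀ p → p * recip p ≤ 1ℚ
  *-recip-≤-1 p with p ≟ 0ℚ
  ... | yes refl = nonNegative⁻¹ 1ℚ
  ... | no  p≢0  = ≤-reflexive (*-inverseʳ p {{≢-nonZero p≢0}})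

  recip-nonneg : ∀ {p} → 0ℚ ≤ p → 0ℚ ≤ recip p
  recip-nonneg {p} 0≤p with p ≟ 0ℚ
  ... | yes _   = ≤-refl
  ... | no  p≢0 = <⇒≤ (positive⁻¹ _ {{1/pos⇒pos p {{pos}}}})
    where pos = nonNeg∧nonZero⇒pos p {{nonNegative 0≤p}} {{≢-nonZero p≢0}}

  ≡*recip* : ∀ {p q} → (q ≡ 0ℚ → p ≡ 0ℚ) → p ≡ p * recip q * q
  ≡*recip* {p} {q} q≡0⇒p≡0 with q ≟ 0ℚ
  ... | yes q≡0 = trans (q≡0⇒p≡0 q≡0) (sym (trans (cong (_* q) (*-zeroʳ p)) (*-zeroˡ q)))
  ... | no  q≢0 = sym (begin
    p * (1/ q) {{≢-nonZero q≢0}} * q    ≡⟨ *-assoc p _ q ⟩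
    p * ((1/ q) {{≢-nonZero q≢0}} * q)  ≡⟨ cong (p *_) (*-inverseˡ q {{≢-nonZero q≢0}}) ⟩
    p * 1ℚ                              ≡⟨ *-identityʳ p ⟩
    p                                   ∎)
    where open ≡-Reasoning

  recip-antitone : ∀ {p q} → 0ℚ < p → p ≤ q → recip q ≤ recip p
  recip-antitone {p} {q} 0<p p≤q = begin
    recip q                    ≡⟨ sym (*-identityʳ (recip q)) ⟩
    recip q * 1ℚ               ≡⟨ cong (recip q *_) (sym (*-recip (≢-sym (<⇒≢ 0<p)))) ⟩
    recip q * (p * recip p)    ≤⟨ *-monoˡ-≤-0≤ (recip-nonneg 0≤q) (*-monoʳ-≤-0≤ (recip-nonneg 0≤p) p≤q) ⟩
    recip q * (q * recip p)    ≡⟨ sym (*-assoc (recip q) q (recip p)) ⟩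
    recip q * q * recip p      ≡⟨ cong (_* recip p) (trans (*-comm (recip q) q) (*-recip (≢-sym (<⇒≢ 0<q)))) ⟩
    1ℚ * recip p               ≡⟨ *-identityˡ (recip p) ⟩
    recip p                    ∎
    where
    open ≤-Reasoning
    0≤p = <⇒≤ 0<p
    0<q = <-≤-trans 0<p p≤q
    0≤q = <⇒≤ 0<q

  sum-mono-≤ : ∀ {n} {f g : Vector ℚ n} → (∀ i → f i ≤ g i) → sum f ≤ sum g
  sum-mono-≤ {zero}  _   = ≤-refl
  sum-mono-≤ {suc n} f≤g = +-mono-≤ (f≤g Fin.zero) (sum-mono-≤ (λ i → f≤g (Fin.suc i)))

  sum-zero : ∀ {n} {f : Vector ℚ n} → (∀ i → f i ≡ 0ℚ) → sum f ≡ 0ℚ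
  sum-zero {n} f≡0 = trans (sum-cong-≗ f≡0) (sum-replicate-zero n)

  sum-nonneg : ∀ {n} {f : Vector ℚ n} → (∀ i → 0ℚ ≤ f i) → 0ℚ ≤ sum f
  sum-nonneg {n} {f} 0≤f = subst (_≤ sum f) (sum-replicate-zero n) (sum-mono-≤ 0≤f)

  term≤sum : ∀ {n} {f : Vector ℚ n} → (∀ i → 0ℚ ≤ f i) → ∀ i → f i ≤ sum f
  term≤sum {suc n} {f} 0≤f i =
    ≤-by-gap (sum (removeAt f i)) (sum-nonneg {f = removeAt f i} (λ _ → 0≤f _)) (sym (sum-remove {i = i} f))

  sum-one : ∀ n → ∑[ i < n ] 1ℚ ≡ fromℕ n
  sum-one zero    = refl
  sum-one (suc n) = trans (cong (1ℚ +_) (sum-one n)) (sym (fromℤ-+ (ℤ.+ 1) (ℤ.+ n)))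

  ∑-neg : ∀ {n} (f : Vector ℚ n) → ∑[ i < n ] (- f i) ≡ - sum f
  ∑-neg {zero}  f = refl
  ∑-neg {suc n} f = trans (cong (- f Fin.zero +_) (∑-neg (λ i → f (Fin.suc i))))
                          (sym (neg-distrib-+ (f Fin.zero) _))

  ∑-distrib-sub : ∀ {n} (f g : Vector ℚ n) → ∑[ i < n ] (f i - g i) ≡ sum f - sum g
  ∑-distrib-sub f g = trans (∑-distrib-+ f (λ i → - g i)) (cong (sum f +_) (∑-neg g))

  ∑-*ˡ : ∀ {n} c (f : Vector ℚ n) → ∑[ i < n ] (c * f i) ≡ c * sum f
  ∑-*ˡ c f = sym (*-distribˡ-sum c f)

  ∑∑-distrib-+ : ∀ {m n} (F G : Fin m → Fin n → ℚ) →
                 ∑[ i < m ] ∑[ j < n ] (F i j + G i j)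
                 ≡ ∑[ i < m ] ∑[ j < n ] F i j + ∑[ i < m ] ∑[ j < n ] G i j
  ∑∑-distrib-+ {m} {n} F G = trans (sum-cong-≗ (λ i → ∑-distrib-+ (F i) (G i)))
                                   (∑-distrib-+ (λ i → ∑[ j < n ] F i j) (λ i → ∑[ j < n ] G i j))

  ∑∑-symmetrise : ∀ {n} (F T : Fin n → Fin n → ℚ) → (∀ i j → F i j ≡ T i j + T j i) →
                  ∑[ i < n ] ∑[ j < n ] F i j ≡ ∑[ i < n ] ∑[ j < n ] T i j + ∑[ i < n ] ∑[ j < n ] T i j
  ∑∑-symmetrise {n} F T F≡T+Tᵀ = trans (sum-cong-≗ (λ i → sum-cong-≗ (F≡T+Tᵀ i)))
    (trans (∑∑-distrib-+ T (λ i j → T j i))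
           (cong (∑[ i < n ] ∑[ j < n ] T i j +_) (∑-comm (λ i j → T j i))))

  sum*sum : ∀ {m n} (f : Vector ℚ m) (g : Vector ℚ n) →
            sum f * sum g ≡ ∑[ i < m ] ∑[ j < n ] (f i * g j)
  sum*sum f g = trans (*-distribʳ-sum (sum g) f) (sum-cong-≗ (λ i → *-distribˡ-sum (f i) g))

  fromℤ-Σℤ : ∀ m (g : Fin m → ℤ.ℤ) → fromℤ (Σℤ m g) ≡ ∑[ i < m ] fromℤ (g i)
  fromℤ-Σℤ zero    g = refl
  fromℤ-Σℤ (suc m) g = trans (fromℤ-+ (g Fin.zero) _) 
                             (cong (fromℤ (g Fin.zero) +_) (fromℤ-Σℤ m (λ i → g (Fin.suc i))))

  Σℤ-cong : ∀ m {g h : Fin m → ℤ.ℤ} → (∀ i → g i ≡ h i) → Σℤ m g ≡ Σℤ m h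
  Σℤ-cong zero    g≡h = refl
  Σℤ-cong (suc m) g≡h = cong₂ ℤ._+_ (g≡h Fin.zero) (Σℤ-cong m (λ i → g≡h (Fin.suc i)))

  double-cancel-≤ : ∀ {p q} → p + p ≤ q + q → p ≤ q
  double-cancel-≤ 2p≤2q = ≮⇒≥ (λ q<p → <-irrefl refl (<-≤-trans (+-mono-< q<p q<p) 2p≤2q))

  -- c² ≤ Y_v Y_w = (H_v R_w) (H_w R_v), then AM-GM for each pair (v, w).
  ∑∑-min-≤-sum*sum : ∀ {n} (Y H R : Vector ℚ n) (c : Fin n → Fin n → ℚ) →
    (∀ u → 0ℚ ≤ H u) → (∀ u → 0ℚ ≤ R u) → (∀ u → Y u ≡ R u * H u) →
    (∀ v w → 0ℚ ≤ c v w) → (∀ v w → c v w ≤ Y v) → (∀ v w → c v w ≤ Y w) →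
    ∑[ v < n ] ∑[ w < n ] c v w ≤ sum H * sum R
  ∑∑-min-≤-sum*sum {n} Y H R c 0≤H 0≤R Y≡RH 0≤c c≤Yv c≤Yw = double-cancel-≤ (begin
    C + C                                                     ≡⟨ ∑∑-distrib-+ c c ⟨
    ∑[ v < n ] ∑[ w < n ] (c v w + c v w)                     ≤⟨ sum-mono-≤ (λ v → sum-mono-≤ (pair v)) ⟩
    ∑[ v < n ] ∑[ w < n ] (H v * R w + H w * R v)             ≡⟨ ∑∑-symmetrise _ (λ v w → H v * R w) (λ _ _ → refl) ⟩
    ∑[ v < n ] ∑[ w < n ] (H v * R w) + ∑[ v < n ] ∑[ w < n ] (H v * R w)
                                                              ≡⟨ cong₂ _+_ (sum*sum H R) (sum*sum H R) ⟨
    sum H * sum R + sum H * sum R                             ∎)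
    where
    open ≤-Reasoning
    C = ∑[ v < n ] ∑[ w < n ] c v w
    regroup : ∀ rv hv rw hw → (rv * hv) * (rw * hw) ≡ (hv * rw) * (hw * rv)
    regroup = solve-∀ ℚ-ring
    pair : ∀ v w → c v w + c v w ≤ H v * R w + H w * R v
    pair v w = amgm₂ {c v w} (0≤* (0≤H v) (0≤R w)) (0≤* (0≤H w) (0≤R v)) (begin
      c v w * c v w        ≤⟨ *-monoˡ-≤-0≤ (0≤c v w) (c≤Yw v w) ⟩
      c v w * Y w          ≤⟨ *-monoʳ-≤-0≤ (≤-trans (0≤c v w) (c≤Yw v w)) (c≤Yv v w) ⟩
      Y v * Y w            ≡⟨ cong₂ _*_ (Y≡RH v) (Y≡RH w) ⟩
      (R v * H v) * (R w * H w)  ≡⟨ regroup (R v) (H v) (R w) (H w) ⟩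
      (H v * R w) * (H w * R v)  ∎)

  -- Weighted AM-GM; the weights make the sum over the vertices collapse to N (54 ΣH + N²) below.
  27Nrh≤ : ∀ {N r h} → 0ℚ ≤ N → 0ℚ ≤ r → 0ℚ ≤ h →
           fromℕ 27 * N * (r * h) ≤ fromℕ 27 * N * h + N * N * r + fromℕ 27 * ((r * h) * (r * h))
  27Nrh≤ {N} {r} {h} 0≤N 0≤r 0≤h =
    subst (_≤ fromℕ 27 * N * h + N * N * r + fromℕ 27 * ((r * h) * (r * h))) (triple N (r * h))
      (amgm₃ {fromℕ 9 * N * (r * h)} (0≤* (0≤* 0≤27 0≤N) 0≤h) (0≤* (0≤sq N) 0≤r) (0≤* 0≤27 (0≤sq (r * h)))
             (≤-reflexive (cube N r h)))
    where
    0≤27 = nonNegative⁻¹ (fromℕ 27)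
    triple : ∀ N y → fromℕ 9 * N * y + fromℕ 9 * N * y + fromℕ 9 * N * y ≡ fromℕ 27 * N * y
    triple = solve-∀ ℚ-ring
    cube : ∀ N r h → (fromℕ 9 * N * (r * h)) * (fromℕ 9 * N * (r * h)) * (fromℕ 9 * N * (r * h))
                   ≡ (fromℕ 27 * N * h) * (N * N * r) * (fromℕ 27 * ((r * h) * (r * h)))
    cube = solve-∀ ℚ-ring

  27∑Y≤54∑H+n² : ∀ n (Y H R : Vector ℚ n) →
    (∀ u → 0ℚ ≤ H u) → (∀ u → 0ℚ ≤ R u) → (∀ u → Y u ≡ R u * H u) →
    ∑[ u < n ] (Y u * Y u) ≤ sum H * sum R → sum R ≤ fromℕ n →
    fromℕ 27 * sum Y ≤ fromℕ 54 * sum H + fromℕ n * fromℕ n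
  27∑Y≤54∑H+n² zero      _ _ _ _   _   _    _         _    = ≤-refl
  27∑Y≤54∑H+n² n@(suc _) Y H R 0≤H 0≤R Y≡RH ∑Y²≤∑H∑R ∑R≤N =
    *-cancelˡ-≤-pos N (begin
      N * (fromℕ 27 * sum Y)                                  ≡⟨ regroup N (sum Y) ⟩
      a * sum Y                                               ≡⟨ ∑-*ˡ a Y ⟨
      ∑[ u < n ] (a * Y u)                                    ≤⟨ sum-mono-≤ vertex ⟩
      ∑[ u < n ] (a * H u + b * R u + fromℕ 27 * (Y u * Y u)) ≡⟨ sum-linear ⟩
      a * σ + b * τ + fromℕ 27 * S₂                           ≤⟨ +-mono-≤ (+-monoʳ-≤ (a * σ) bτ≤bN) 27S₂≤27σN ⟩
      a * σ + b * N + fromℕ 27 * (σ * N)                      ≡⟨ collect N σ ⟩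
      N * (fromℕ 54 * σ + N * N)                              ∎)
    where
    open ≤-Reasoning
    N = fromℕ n
    a = fromℕ 27 * N
    b = N * N
    σ = sum H
    τ = sum R
    S₂ = ∑[ u < n ] (Y u * Y u)
    regroup : ∀ N y → N * (fromℕ 27 * y) ≡ fromℕ 27 * N * y
    regroup = solve-∀ ℚ-ring
    collect : ∀ N σ → fromℕ 27 * N * σ + N * N * N + fromℕ 27 * (σ * N) ≡ N * (fromℕ 54 * σ + N * N)
    collect = solve-∀ ℚ-ring
    vertex : ∀ u → a * Y u ≤ a * H u + b * R u + fromℕ 27 * (Y u * Y u)
    vertex u = subst (λ y → a * y ≤ a * H u + b * R u + fromℕ 27 * (y * y)) (sym (Y≡RH u))
                     (27Nrh≤ (nonNegative⁻¹ N) (0≤R u) (0≤H u))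
    sum-linear : ∑[ u < n ] (a * H u + b * R u + fromℕ 27 * (Y u * Y u)) ≡ a * σ + b * τ + fromℕ 27 * S₂
    sum-linear = trans (∑-distrib-+ (λ u → a * H u + b * R u) (λ u → fromℕ 27 * (Y u * Y u)))
      (cong₂ _+_ (trans (∑-distrib-+ (λ u → a * H u) (λ u → b * R u)) (cong₂ _+_ (∑-*ˡ a H) (∑-*ˡ b R)))
                 (∑-*ˡ (fromℕ 27) (λ u → Y u * Y u)))
    bτ≤bN : b * τ ≤ b * N
    bτ≤bN = *-monoˡ-≤-0≤ (0≤sq N) ∑R≤N
    27S₂≤27σN : fromℕ 27 * S₂ ≤ fromℕ 27 * (σ * N)
    27S₂≤27σN = *-monoˡ-≤-0≤ (nonNegative⁻¹ (fromℕ 27))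
                             (≤-trans ∑Y²≤∑H∑R (*-monoˡ-≤-0≤ (sum-nonneg 0≤H) ∑R≤N))

module Degrees {n : ℕ} (G : Graph n) (f : EdgeLabelling G) where
  open import Data.Rational using (ℚ; 0ℚ; 1ℚ; _+_; _*_; -_; _-_; _≤_)
  open import Data.Rational.Properties
  import Data.Integer as ℤ
  import Data.Integer.Properties as ℤP
  import Data.Fin.Properties as FinP
  open import Algebra.Properties.Semiring.Sum (CommutativeRing.semiring +-*-commutativeRing)
    using (sum; sum-syntax; ∑-comm; ∑-distrib-+; *-distribʳ-sum; sum-cong-≗)
  open Inequalities

  χ₊ χ₋ : Bool → Sign → ℚ
  χ₊ true plus  = 1ℚ
  χ₊ true minus = 0ℚ
  χ₊ false _    = 0ℚ
  χ₋ true plus  = 0ℚ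
  χ₋ true minus = 1ℚ
  χ₋ false _    = 0ℚ

  PlusEdge MinusEdge : Fin n → Fin n → Set
  PlusEdge  u v = T (adj G u v) × lab f u v ≡ plus
  MinusEdge u v = T (adj G u v) × lab f u v ≡ minus

  e₊ e₋ : Fin n → Fin n → ℚ
  e₊ u v = χ₊ (adj G u v) (lab f u v)
  e₋ u v = χ₋ (adj G u v) (lab f u v)

  e₊-cases : ∀ u v → e₊ u v ≡ 0ℚ ⊎ (e₊ u v ≡ 1ℚ × PlusEdge u v)
  e₊-cases u v with adj G u v | lab f u v
  ... | true  | plus  = inj₂ (refl , _ , refl)
  ... | true  | minus = inj₁ refl
  ... | false | _     = inj₁ refl

  e₋-cases : ∀ u v → e₋ u v ≡ 0ℚ ⊎ (e₋ u v ≡ 1ℚ × MinusEdge u v)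
  e₋-cases u v with adj G u v | lab f u v
  ... | true  | plus  = inj₁ refl
  ... | true  | minus = inj₂ (refl , _ , refl)
  ... | false | _     = inj₁ refl

  e₊-sym : ∀ u v → e₊ u v ≡ e₊ v u
  e₊-sym u v = cong₂ χ₊ (Graph.sym G u v) (lab-sym f u v)

  e₋-sym : ∀ u v → e₋ u v ≡ e₋ v u
  e₋-sym u v = cong₂ χ₋ (Graph.sym G u v) (lab-sym f u v)

  contrib-sym : ∀ u v → contrib G f u v ≡ contrib G f v u
  contrib-sym u v with adj G u v | adj G v u | Graph.sym G u v
  ... | true  | true  | refl = cong ⟦_⟧ (lab-sym f u v)
  ... | false | false | refl = refl

  contrib-diag : ∀ u → contrib G f u u ≡ ℤ.0ℤ
  contrib-diag u rewrite irref G u = refl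

  e₊-nonneg : ∀ u v → 0ℚ ≤ e₊ u v
  e₊-nonneg u v = indicator-nonneg (Sum.map₂ proj₁ (e₊-cases u v))

  e₋-nonneg : ∀ u v → 0ℚ ≤ e₋ u v
  e₋-nonneg u v = indicator-nonneg (Sum.map₂ proj₁ (e₋-cases u v))

  e₊≤1 : ∀ u v → e₊ u v ≤ 1ℚ
  e₊≤1 u v = indicator≤1 (Sum.map₂ proj₁ (e₊-cases u v))

  fromℤ-contrib : ∀ u v → fromℤ (contrib G f u v) ≡ e₊ u v - e₋ u v
  fromℤ-contrib u v with adj G u v
  ... | false = refl
  ... | true with lab f u v
  ...   | plus  = refl
  ...   | minus = refl

  deg₊ deg₋ : Fin n → ℚ
  deg₊ u = ∑[ v < n ] e₊ u v
  deg₋ u = ∑[ v < n ] e₋ u v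

  deg₊-nonneg : ∀ u → 0ℚ ≤ deg₊ u
  deg₊-nonneg u = sum-nonneg (e₊-nonneg u)

  deg₋-nonneg : ∀ u → 0ℚ ≤ deg₋ u
  deg₋-nonneg u = sum-nonneg (e₋-nonneg u)

  s : Fin n → ℚ
  s u = deg₊ u - deg₋ u

  fromℤ-sv : ∀ u → fromℤ (sv G f u) ≡ s u
  fromℤ-sv u = trans (fromℤ-Σℤ n (contrib G f u))
                     (trans (sum-cong-≗ (fromℤ-contrib u)) (∑-distrib-sub (e₊ u) (e₋ u)))

  upper : Fin n → Fin n → ℤ.ℤ
  upper i j with i Fin.<? j
  ... | yes _ = contrib G f i j
  ... | no  _ = ℤ.0ℤ

  contrib-split : ∀ i j → contrib G f i j ≡ upper i j ℤ.+ upper j i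
  contrib-split i j with i Fin.<? j | j Fin.<? i
  ... | yes i<j | yes j<i = ⊥-elim (FinP.<-asym i<j j<i)
  ... | yes _   | no  _   = sym (ℤP.+-identityʳ _)
  ... | no  _   | yes _   = trans (contrib-sym i j) (sym (ℤP.+-identityˡ _))
  ... | no  i≮j | no  j≮i with FinP.<-cmp i j
  ...   | tri< i<j _ _ = ⊥-elim (i≮j i<j)
  ...   | tri> _ _ j<i = ⊥-elim (j≮i j<i)
  ...   | tri≈ _ refl _ = contrib-diag i

  mutual
    weight-upper : weight G f ≡ Σℤ n (λ i → Σℤ n (upper i))
    weight-upper = Σℤ-cong n (λ i → Σℤ-cong n (summand-upper i))

    -- The selector in the summand of weight is local to Defs, so the left side is left to inference.
    summand-upper : ∀ i j → _ ≡ upper i j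
    summand-upper i j with i Fin.<? j
    ... | yes _ = refl
    ... | no  _ = refl

  handshake : fromℤ (weight G f) + fromℤ (weight G f) ≡ ∑[ u < n ] s u
  handshake = begin
    fromℤ (weight G f) + fromℤ (weight G f)            ≡⟨ cong₂ _+_ fromℤ-weight fromℤ-weight ⟩
    ∑[ i < n ] ∑[ j < n ] U i j + ∑[ i < n ] ∑[ j < n ] U i j
                                                        ≡⟨ ∑∑-symmetrise _ U fromℤ-contrib-split ⟨
    ∑[ i < n ] ∑[ j < n ] fromℤ (contrib G f i j)      ≡⟨ sum-cong-≗ (λ i → fromℤ-Σℤ n (contrib G f i)) ⟨
    ∑[ u < n ] fromℤ (sv G f u)                        ≡⟨ sum-cong-≗ fromℤ-sv ⟩
    ∑[ u < n ] s u                                     ∎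
    where
    open ≡-Reasoning
    U : Fin n → Fin n → ℚ
    U i j = fromℤ (upper i j)
    fromℤ-weight : fromℤ (weight G f) ≡ ∑[ i < n ] ∑[ j < n ] U i j
    fromℤ-weight = trans (cong fromℤ weight-upper)
                         (trans (fromℤ-Σℤ n _) (sum-cong-≗ (λ i → fromℤ-Σℤ n (upper i))))
    fromℤ-contrib-split : ∀ i j → fromℤ (contrib G f i j) ≡ U i j + U j i
    fromℤ-contrib-split i j = trans (cong fromℤ (contrib-split i j)) (fromℤ-+ (upper i j) (upper j i))

  codeg : Fin n → Fin n → ℚ
  codeg v w = ∑[ u < n ] (e₊ u v * e₊ u w)

  ∑deg₊²≡∑∑codeg : ∑[ u < n ] (deg₊ u * deg₊ u) ≡ ∑[ v < n ] ∑[ w < n ] codeg v w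
  ∑deg₊²≡∑∑codeg = begin
    ∑[ u < n ] (deg₊ u * deg₊ u)                          ≡⟨ sum-cong-≗ (λ u → sum*sum (e₊ u) (e₊ u)) ⟩
    ∑[ u < n ] ∑[ v < n ] ∑[ w < n ] (e₊ u v * e₊ u w)   ≡⟨ ∑-comm (λ u v → ∑[ w < n ] (e₊ u v * e₊ u w)) ⟩
    ∑[ v < n ] ∑[ u < n ] ∑[ w < n ] (e₊ u v * e₊ u w)   ≡⟨ sum-cong-≗ (λ v → ∑-comm (λ u w → e₊ u v * e₊ u w)) ⟩
    ∑[ v < n ] ∑[ w < n ] codeg v w                       ∎
    where open ≡-Reasoning

  codeg-nonneg : ∀ v w → 0ℚ ≤ codeg v w
  codeg-nonneg v w = sum-nonneg (λ u → 0≤* (e₊-nonneg u v) (e₊-nonneg u w))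

  codeg≤deg₊ˡ : ∀ v w → codeg v w ≤ deg₊ v
  codeg≤deg₊ˡ v w = sum-mono-≤ (λ u → begin
    e₊ u v * e₊ u w  ≤⟨ *-monoˡ-≤-0≤ (e₊-nonneg u v) (e₊≤1 u w) ⟩
    e₊ u v * 1ℚ      ≡⟨ *-identityʳ (e₊ u v) ⟩
    e₊ u v           ≡⟨ e₊-sym u v ⟩
    e₊ v u           ∎)
    where open ≤-Reasoning

  codeg≤deg₊ʳ : ∀ v w → codeg v w ≤ deg₊ w
  codeg≤deg₊ʳ v w = sum-mono-≤ (λ u → begin
    e₊ u v * e₊ u w  ≤⟨ *-monoʳ-≤-0≤ (e₊-nonneg u w) (e₊≤1 u v) ⟩
    1ℚ * e₊ u w      ≡⟨ *-identityˡ (e₊ u w) ⟩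
    e₊ u w           ≡⟨ e₊-sym u w ⟩
    e₊ w u           ∎)
    where open ≤-Reasoning

  module SEDPair (sed : IsSEDF G f) (str : Structured G f) where

    V₊∩V₋≡∅ : ∀ {u} → InV₊ G f u → InV₋ G f u → ⊥
    V₊∩V₋≡∅ u∈V₊ u∈V₋ = ℤP.<⇒≱ u∈V₋ u∈V₊

    s-nonneg : ∀ {u} → InV₊ G f u → 0ℚ ≤ s u
    s-nonneg {u} u∈V₊ = subst (0ℚ ≤_) (fromℤ-sv u) (fromℤ-mono-≤ u∈V₊)

    deg₊-V₋ : ∀ {v} → InV₋ G f v → deg₊ v ≡ 0ℚ
    deg₊-V₋ {v} v∈V₋ = sum-zero no-plus-edge
      where
      no-plus-edge : ∀ w → e₊ v w ≡ 0ℚ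
      no-plus-edge w with e₊-cases v w
      ... | inj₁ e≡0              = e≡0
      ... | inj₂ (_ , vw-adj , vw-plus) =
        ⊥-elim (V₊∩V₋≡∅ (proj₁ (proj₂ str v w vw-adj vw-plus)) v∈V₋)

    minus-edge⇒e₋≡1 : ∀ {u v} → MinusEdge u v → e₋ u v ≡ 1ℚ
    minus-edge⇒e₋≡1 {u} {v} (uv-adj , uv-minus) with adj G u v
    ... | true = cong (χ₋ true) uv-minus

    -- For v ∈ V₋ there are no plus edges at v, so the closed neighbourhood sum of uv is s_u - deg₋ v + 1.
    minus-edge-bound : ∀ {u v} → InV₊ G f u → MinusEdge u v → 1ℚ ≤ deg₋ v × deg₋ v ≤ s u
    minus-edge-bound {u} {v} u∈V₊ uv@(uv-adj , uv-minus) with proj₁ str u v uv-adj uv-minus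
    ... | inj₂ (u∈V₋ , _) = ⊥-elim (V₊∩V₋≡∅ u∈V₊ u∈V₋)
    ... | inj₁ (_ , v∈V₋) = 1≤deg₋v , 0≤-⇒≤ (subst (0ℚ ≤_) gap≡ (≤⇒0≤- (fromℤ-mono-≤ domination)))
      where
      1≤deg₋v : 1ℚ ≤ deg₋ v
      1≤deg₋v = subst (_≤ deg₋ v) (trans (e₋-sym v u) (minus-edge⇒e₋≡1 uv)) (term≤sum (e₋-nonneg v) u)
      domination : ℤ.1ℤ ℤ.≤ sv G f u ℤ.+ sv G f v ℤ.- ⟦ minus ⟧
      domination = subst (λ σ → ℤ.1ℤ ℤ.≤ sv G f u ℤ.+ sv G f v ℤ.- ⟦ σ ⟧) uv-minus (sed u v uv-adj)
      rearrange : ∀ su p m → su + (p - m) - (- 1ℚ) - 1ℚ ≡ su - m + p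
      rearrange = solve-∀ ℚ-ring
      gap≡ : fromℤ (sv G f u ℤ.+ sv G f v ℤ.- ⟦ minus ⟧) - 1ℚ ≡ s u - deg₋ v
      gap≡ = begin
        fromℤ (sv G f u ℤ.+ sv G f v ℤ.- ⟦ minus ⟧) - 1ℚ
          ≡⟨ cong (_- 1ℚ) (trans (fromℤ-sub (sv G f u ℤ.+ sv G f v) ⟦ minus ⟧)
                                 (cong (_- - 1ℚ) (fromℤ-+ (sv G f u) (sv G f v)))) ⟩
        fromℤ (sv G f u) + fromℤ (sv G f v) - (- 1ℚ) - 1ℚ
          ≡⟨ cong₂ (λ a b → a + b - (- 1ℚ) - 1ℚ) (fromℤ-sv u) (fromℤ-sv v) ⟩
        s u + (deg₊ v - deg₋ v) - (- 1ℚ) - 1ℚ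
          ≡⟨ rearrange (s u) (deg₊ v) (deg₋ v) ⟩
        s u - deg₋ v + deg₊ v
          ≡⟨ trans (cong (s u - deg₋ v +_) (deg₊-V₋ v∈V₋)) (+-identityʳ _) ⟩
        s u - deg₋ v ∎
        where open ≡-Reasoning

    A : Fin n → ℚ
    A u with ℤ.0ℤ ℤ.≤? sv G f u
    ... | yes _ = 1ℚ
    ... | no  _ = 0ℚ

    side : ∀ u → (A u ≡ 0ℚ × InV₋ G f u) ⊎ (A u ≡ 1ℚ × InV₊ G f u)
    side u with ℤ.0ℤ ℤ.≤? sv G f u
    ... | yes u∈V₊ = inj₂ (refl , u∈V₊)
    ... | no  u∉V₊ = inj₁ (refl , ℤP.≰⇒> u∉V₊)

    A-V₊ : ∀ {u} → InV₊ G f u → A u ≡ 1ℚ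
    A-V₊ {u} u∈V₊ with side u
    ... | inj₁ (_ , u∈V₋) = ⊥-elim (V₊∩V₋≡∅ u∈V₊ u∈V₋)
    ... | inj₂ (A≡1 , _)  = A≡1

    A-V₋ : ∀ {u} → InV₋ G f u → A u ≡ 0ℚ
    A-V₋ {u} u∈V₋ with side u
    ... | inj₁ (A≡0 , _)  = A≡0
    ... | inj₂ (_ , u∈V₊) = ⊥-elim (V₊∩V₋≡∅ u∈V₊ u∈V₋)

    A-nonneg : ∀ u → 0ℚ ≤ A u
    A-nonneg u = indicator-nonneg (Sum.map proj₁ proj₁ (side u))

    A≤1 : ∀ u → A u ≤ 1ℚ
    A≤1 u = indicator≤1 (Sum.map proj₁ proj₁ (side u))

    A*deg₊ : ∀ u → A u * deg₊ u ≡ deg₊ u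
    A*deg₊ u with side u
    ... | inj₁ (_ , u∈V₋) = trans (cong (A u *_) (deg₊-V₋ u∈V₋)) (trans (*-zeroʳ (A u)) (sym (deg₊-V₋ u∈V₋)))
    ... | inj₂ (A≡1 , _)  = trans (cong (_* deg₊ u) A≡1) (*-identityˡ (deg₊ u))

    e₋-split : ∀ u v → e₋ u v ≡ A u * e₋ u v + A v * e₋ v u
    e₋-split u v with e₋-cases u v
    ... | inj₁ e≡0 rewrite e≡0 | trans (e₋-sym v u) e≡0 = sym (cong₂ _+_ (*-zeroʳ (A u)) (*-zeroʳ (A v)))
    ... | inj₂ (e≡1 , uv-adj , uv-minus) with proj₁ str u v uv-adj uv-minus
    ...   | inj₁ (u∈V₊ , v∈V₋) rewrite e≡1 | trans (e₋-sym v u) e≡1 | A-V₊ u∈V₊ | A-V₋ v∈V₋ = refl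
    ...   | inj₂ (u∈V₋ , v∈V₊) rewrite e≡1 | trans (e₋-sym v u) e≡1 | A-V₋ u∈V₋ | A-V₊ v∈V₊ = refl

    H R : Fin n → ℚ
    H u = A u * s u
    R u = deg₊ u * recip (H u)

    H-nonneg : ∀ u → 0ℚ ≤ H u
    H-nonneg u with side u
    ... | inj₁ (A≡0 , _)  = ≤-reflexive (sym (trans (cong (_* s u) A≡0) (*-zeroˡ (s u))))
    ... | inj₂ (_ , u∈V₊) = 0≤* (A-nonneg u) (s-nonneg u∈V₊)

    R-nonneg : ∀ u → 0ℚ ≤ R u
    R-nonneg u = 0≤* (deg₊-nonneg u) (recip-nonneg (H-nonneg u))

    H≡0⇒deg₊≡0 : ∀ u → H u ≡ 0ℚ → deg₊ u ≡ 0ℚ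
    H≡0⇒deg₊≡0 u H≡0 with side u
    ... | inj₁ (_ , u∈V₋)   = deg₊-V₋ u∈V₋
    ... | inj₂ (A≡1 , u∈V₊) = begin
      deg₊ u           ≡⟨ p≡[p-m]+m (deg₊ u) (deg₋ u) ⟩
      s u + deg₋ u     ≡⟨ cong₂ _+_ s≡0 (sum-zero no-minus-edge) ⟩
      0ℚ + 0ℚ          ≡⟨ +-identityˡ 0ℚ ⟩
      0ℚ               ∎
      where
      open ≡-Reasoning
      p≡[p-m]+m : ∀ p m → p ≡ (p - m) + m
      p≡[p-m]+m = solve-∀ ℚ-ring
      s≡0 : s u ≡ 0ℚ
      s≡0 = trans (sym (*-identityˡ (s u))) (trans (cong (_* s u) (sym A≡1)) H≡0)
      no-minus-edge : ∀ v → e₋ u v ≡ 0ℚ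
      no-minus-edge v with e₋-cases u v
      ... | inj₁ e≡0      = e≡0
      ... | inj₂ (_ , uv) with minus-edge-bound u∈V₊ uv
      ...   | 1≤deg₋v , deg₋v≤s =
        ⊥-elim (<-irrefl refl (<-≤-trans (positive⁻¹ 1ℚ) (≤-trans 1≤deg₋v (subst (deg₋ v ≤_) s≡0 deg₋v≤s))))

    deg₊≡R*H : ∀ u → deg₊ u ≡ R u * H u
    deg₊≡R*H u = ≡*recip* (H≡0⇒deg₊≡0 u)

    -- u ∈ V₊ covers R_u - 1 = deg₋ u / s_u by charging each minus neighbour v with 1 / deg₋ v ≥ 1 / s_u.
    charge : Fin n → Fin n → ℚ
    charge u v = A u * e₋ u v * recip (deg₋ v)

    charge-nonneg : ∀ u v → 0ℚ ≤ charge u v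
    charge-nonneg u v = 0≤* (0≤* (A-nonneg u) (e₋-nonneg u v)) (recip-nonneg (deg₋-nonneg v))

    charge-vanishes : ∀ u v → A u * e₋ u v ≡ 0ℚ → charge u v ≡ 0ℚ
    charge-vanishes u v Ae≡0 = trans (cong (_* recip (deg₋ v)) Ae≡0) (*-zeroˡ (recip (deg₋ v)))

    R≤A+∑charge : ∀ u → R u ≤ A u + ∑[ v < n ] charge u v
    R≤A+∑charge u with side u
    ... | inj₁ (_ , u∈V₋) = subst (_≤ A u + ∑[ v < n ] charge u v) (sym R≡0)
                                   (0≤+ (A-nonneg u) (sum-nonneg (charge-nonneg u)))
      where
      R≡0 : R u ≡ 0ℚ
      R≡0 = trans (cong (_* recip (H u)) (deg₊-V₋ u∈V₋)) (*-zeroˡ (recip (H u)))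
    ... | inj₂ (A≡1 , u∈V₊) = begin
      R u                                           ≡⟨ cong (λ h → deg₊ u * recip h) H≡s ⟩
      deg₊ u * recip (s u)                          ≡⟨ split (deg₊ u) (deg₋ u) (recip (s u)) ⟩
      s u * recip (s u) + deg₋ u * recip (s u)      ≤⟨ +-mono-≤ (*-recip-≤-1 (s u))
                                                         (≤-reflexive (*-distribʳ-sum (recip (s u)) (e₋ u))) ⟩
      1ℚ + ∑[ v < n ] (e₋ u v * recip (s u))        ≤⟨ +-monoʳ-≤ 1ℚ (sum-mono-≤ share≤) ⟩
      1ℚ + ∑[ v < n ] (e₋ u v * recip (deg₋ v))     ≡⟨ cong₂ _+_ A≡1 (sum-cong-≗ (λ v → cong (_* recip (deg₋ v))
                                                                                       (A*e₋≡e₋ v))) ⟨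
      A u + ∑[ v < n ] charge u v                   ∎
      where
      open ≤-Reasoning
      split : ∀ p m r → p * r ≡ (p - m) * r + m * r
      split = solve-∀ ℚ-ring
      H≡s : H u ≡ s u
      H≡s = trans (cong (_* s u) A≡1) (*-identityˡ (s u))
      A*e₋≡e₋ : ∀ v → A u * e₋ u v ≡ e₋ u v
      A*e₋≡e₋ v = trans (cong (_* e₋ u v) A≡1) (*-identityˡ (e₋ u v))
      share≤ : ∀ v → e₋ u v * recip (s u) ≤ e₋ u v * recip (deg₋ v)
      share≤ v with e₋-cases u v
      ... | inj₁ e≡0 rewrite e≡0 = ≤-reflexive (trans (*-zeroˡ (recip (s u))) (sym (*-zeroˡ (recip (deg₋ v)))))
      ... | inj₂ (_ , uv) with minus-edge-bound u∈V₊ uv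
      ...   | 1≤deg₋v , deg₋v≤s =
        *-monoˡ-≤-0≤ (e₋-nonneg u v) (recip-antitone (<-≤-trans (positive⁻¹ 1ℚ) 1≤deg₋v) deg₋v≤s)

    ∑charge≤1-A : ∀ v → ∑[ u < n ] charge u v ≤ 1ℚ - A v
    ∑charge≤1-A v with side v
    ... | inj₂ (A≡1 , v∈V₊) =
      ≤-reflexive (trans (sum-zero no-charge) (sym (trans (cong (λ a → 1ℚ - a) A≡1) (+-inverseʳ 1ℚ))))
      where
      no-charge : ∀ u → charge u v ≡ 0ℚ
      no-charge u with e₋-cases u v
      ... | inj₁ e≡0 = charge-vanishes u v (trans (cong (A u *_) e≡0) (*-zeroʳ (A u)))
      ... | inj₂ (_ , uv-adj , uv-minus) with proj₁ str u v uv-adj uv-minus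
      ...   | inj₁ (_ , v∈V₋) = ⊥-elim (V₊∩V₋≡∅ v∈V₊ v∈V₋)
      ...   | inj₂ (u∈V₋ , _) = charge-vanishes u v (trans (cong (_* e₋ u v) (A-V₋ u∈V₋)) (*-zeroˡ (e₋ u v)))
    ... | inj₁ (A≡0 , _) = begin
      ∑[ u < n ] charge u v                  ≤⟨ sum-mono-≤ (λ u → *-monoʳ-≤-0≤ (recip-nonneg (deg₋-nonneg v))
                                                                                (A*e₋≤e₋ u)) ⟩
      ∑[ u < n ] (e₋ u v * recip (deg₋ v))   ≡⟨ *-distribʳ-sum (recip (deg₋ v)) (λ u → e₋ u v) ⟨
      (∑[ u < n ] e₋ u v) * recip (deg₋ v)   ≡⟨ cong (_* recip (deg₋ v)) (sum-cong-≗ (λ u → e₋-sym u v)) ⟩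
      deg₋ v * recip (deg₋ v)                ≤⟨ *-recip-≤-1 (deg₋ v) ⟩
      1ℚ                                     ≡⟨ cong (λ a → 1ℚ - a) A≡0 ⟨
      1ℚ - A v                               ∎
      where
      open ≤-Reasoning
      A*e₋≤e₋ : ∀ u → A u * e₋ u v ≤ e₋ u v
      A*e₋≤e₋ u = subst (A u * e₋ u v ≤_) (*-identityˡ (e₋ u v)) (*-monoʳ-≤-0≤ (e₋-nonneg u v) (A≤1 u))

    ∑R≤n : sum R ≤ fromℕ n
    ∑R≤n = begin
      sum R                                          ≤⟨ sum-mono-≤ R≤A+∑charge ⟩
      ∑[ u < n ] (A u + ∑[ v < n ] charge u v)       ≡⟨ ∑-distrib-+ A (λ u → ∑[ v < n ] charge u v) ⟩
      sum A + ∑[ u < n ] ∑[ v < n ] charge u v       ≡⟨ cong (sum A +_) (∑-comm charge) ⟩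
      sum A + ∑[ v < n ] ∑[ u < n ] charge u v       ≤⟨ +-monoʳ-≤ (sum A) (sum-mono-≤ ∑charge≤1-A) ⟩
      sum A + ∑[ v < n ] (1ℚ - A v)                  ≡⟨ ∑-distrib-+ A (λ v → 1ℚ - A v) ⟨
      ∑[ v < n ] (A v + (1ℚ - A v))                  ≡⟨ sum-cong-≗ (λ v → a+[1-a]≡1 (A v)) ⟩
      ∑[ v < n ] 1ℚ                                  ≡⟨ sum-one n ⟩
      fromℕ n                                        ∎
      where
      open ≤-Reasoning
      a+[1-a]≡1 : ∀ a → a + (1ℚ - a) ≡ 1ℚ
      a+[1-a]≡1 = solve-∀ ℚ-ring

    -- Every minus edge has exactly one endpoint in V₊.
    ∑deg₋≡2∑A*deg₋ : sum deg₋ ≡ ∑[ u < n ] (A u * deg₋ u) + ∑[ u < n ] (A u * deg₋ u)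
    ∑deg₋≡2∑A*deg₋ = trans (∑∑-symmetrise e₋ (λ u v → A u * e₋ u v) e₋-split)
                           (cong₂ _+_ ∑∑A*e₋≡∑A*deg₋ ∑∑A*e₋≡∑A*deg₋)
      where
      ∑∑A*e₋≡∑A*deg₋ : ∑[ u < n ] ∑[ v < n ] (A u * e₋ u v) ≡ ∑[ u < n ] (A u * deg₋ u)
      ∑∑A*e₋≡∑A*deg₋ = sum-cong-≗ (λ u → ∑-*ˡ (A u) (e₋ u))

    ∑H≡∑deg₊-∑A*deg₋ : sum H ≡ sum deg₊ - ∑[ u < n ] (A u * deg₋ u)
    ∑H≡∑deg₊-∑A*deg₋ = begin
      ∑[ u < n ] (A u * (deg₊ u - deg₋ u))            ≡⟨ sum-cong-≗ (λ u → *-distribˡ-sub (A u) (deg₊ u) (deg₋ u)) ⟩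
      ∑[ u < n ] (A u * deg₊ u - A u * deg₋ u)        ≡⟨ sum-cong-≗ (λ u → cong (_- A u * deg₋ u) (A*deg₊ u)) ⟩
      ∑[ u < n ] (deg₊ u - A u * deg₋ u)              ≡⟨ ∑-distrib-sub deg₊ (λ u → A u * deg₋ u) ⟩
      sum deg₊ - ∑[ u < n ] (A u * deg₋ u)            ∎
      where
      open ≡-Reasoning
      *-distribˡ-sub : ∀ a p m → a * (p - m) ≡ a * p - a * m
      *-distribˡ-sub = solve-∀ ℚ-ring

    weight-identity : fromℤ (weight G f) + fromℤ (weight G f) ≡ (sum H + sum H) - sum deg₊
    weight-identity = begin
      fromℤ (weight G f) + fromℤ (weight G f)  ≡⟨ handshake ⟩
      ∑[ u < n ] s u                           ≡⟨ ∑-distrib-sub deg₊ deg₋ ⟩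
      sum deg₊ - sum deg₋                      ≡⟨ cong (λ x → sum deg₊ - x) ∑deg₋≡2∑A*deg₋ ⟩
      sum deg₊ - (P + P)                       ≡⟨ regroup (sum deg₊) P ⟩
      ((sum deg₊ - P) + (sum deg₊ - P)) - sum deg₊
                                               ≡⟨ cong (λ σ → (σ + σ) - sum deg₊) ∑H≡∑deg₊-∑A*deg₋ ⟨
      (sum H + sum H) - sum deg₊               ∎
      where
      open ≡-Reasoning
      P = ∑[ u < n ] (A u * deg₋ u)
      regroup : ∀ y p → y - (p + p) ≡ ((y - p) + (y - p)) - y
      regroup = solve-∀ ℚ-ring

    ∑deg₊²≤∑H*∑R : ∑[ u < n ] (deg₊ u * deg₊ u) ≤ sum H * sum R
    ∑deg₊²≤∑H*∑R = subst (_≤ sum H * sum R) (sym ∑deg₊²≡∑∑codeg)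
      (∑∑-min-≤-sum*sum deg₊ H R codeg H-nonneg R-nonneg deg₊≡R*H codeg-nonneg codeg≤deg₊ˡ codeg≤deg₊ʳ)

    weight-bound : - (fromℕ n * fromℕ n) ≤ fromℕ 54 * fromℤ (weight G f)
    weight-bound = begin
      - (N * N)                                  ≤⟨ ≤-by-gap _ (≤⇒0≤- 27∑deg₊≤54∑H+n²)
                                                                  (rearrange N (sum H) (sum deg₊)) ⟩
      fromℕ 27 * ((sum H + sum H) - sum deg₊)    ≡⟨ cong (fromℕ 27 *_) weight-identity ⟨
      fromℕ 27 * (W + W)                         ≡⟨ double W ⟩
      fromℕ 54 * W                               ∎
      where
      open ≤-Reasoning
      N = fromℕ n
      W = fromℤ (weight G f)
      27∑deg₊≤54∑H+n² : fromℕ 27 * sum deg₊ ≤ fromℕ 54 * sum H + N * N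
      27∑deg₊≤54∑H+n² = 27∑Y≤54∑H+n² n deg₊ H R H-nonneg R-nonneg deg₊≡R*H ∑deg₊²≤∑H*∑R ∑R≤n
      rearrange : ∀ N σ y → - (N * N) + ((fromℕ 54 * σ + N * N) - fromℕ 27 * y) ≡ fromℕ 27 * ((σ + σ) - y)
      rearrange = solve-∀ ℚ-ring
      double : ∀ w → fromℕ 27 * (w + w) ≡ fromℕ 54 * w
      double = solve-∀ ℚ-ring

import Data.Nat
import Data.Rational as ℚ
import Data.Integer.Properties as ℤP
open import Data.Integer using (+_; -_; _*_; _≤_)
open Inequalities using (fromℕ; fromℤ-neg; fromℤ-*; fromℤ-cancel-≤)
open Degrees.SEDPair using (weight-bound)

theorem3 : (n : ℕ) (G : Graph n) (f : EdgeLabelling G) →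
    IsSEDF G f → Structured G f →
    - (+ (n Data.Nat.* n)) ≤ + 54 * weight G f
theorem3 n G f sed str =
  fromℤ-cancel-≤ (subst₂ ℚ._≤_ (sym fromℤ-[-n²]) (sym (fromℤ-* (+ 54) (weight G f)))
                               (weight-bound G f sed str))
  where
  fromℤ-[-n²] : fromℤ (- (+ (n Data.Nat.* n))) ≡ ℚ.- (fromℕ n ℚ.* fromℕ n)
  fromℤ-[-n²] = trans (fromℤ-neg (+ (n Data.Nat.* n)))
                      (cong ℚ.-_ (trans (cong fromℤ (ℤP.pos-* n n)) (fromℤ-* (+ n) (+ n))))
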